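{- Let $T$ be the tree rooted at $r$ whose root has three children $u,v,w$, where $v$ and $w$ are leaves and $u$ has exactly four children $a_1,a_2,a_3,a_4$, all leaves. Let $e$ be the tree edge $rv$. Let the link set be $L=\{\ell_1,\dots,\ell_6\}$ with $\ell_1=vw$, $\ell_2=a_4v$, $\ell_3=a_2w$, $\ell_4=a_1w$, $\ell_5=a_1a_2$, $\ell_6=a_3a_4$. The links $\ell_1,\ell_2,\ell_3,\ell_4$ (whose least common ancestor is $r$) are cross-links and $\ell_5,\ell_6$ (whose least common ancestor is $u$) are in-links; write a vector $z\in\mathbb{R}^L$ as $z=(x,y)$ with $x=(z_{\ell_1},\dots,z_{\ell_4})$ and $y=(z_{\ell_5},z_{\ell_6})$. Then the point $(x,y)=(\frac12,\frac12,\frac12,\frac12,\frac12,1)$ (listed in the order $\ell_1,\dots,\ell_6$) is an extreme point of ${\rm odd\text{ - }LP}(T,L)$, and $(x,\alpha y)\notin{\rm TAP}(T,L)$ for every $\alpha<2$.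
   Context: For a tree $T$ on vertex set $V$ and a set $L$ of links (extra edges on $V$), a link $\ell$ covers a tree edge $f$ if the unique cycle of $T+\ell$ contains $f$; ${\rm cov}(f)$ is the set of links covering $f$. A set $A\subseteq L$ is a feasible TAP solution if $(V,E(T)\cup A)$ is two-edge-connected, equivalently every tree edge is covered by some link of $A$. ${\rm TAP}(T,L)$ denotes the set of vectors $z\in\mathbb{R}^L$ that dominate a convex combination of incidence vectors of feasible TAP solutions, i.e., $z\ge\sum_i\lambda_i\chi^{B_i}$ with $\lambda_i\ge0$, $\sum_i\lambda_i=1$, each $B_i$ feasible. For $S\subseteq V$, $\delta(S)$ is the set of links and tree edges with exactly one endpoint in $S$. ${\rm odd\text{ - }LP}(T,L)$ is the polyhedron $\{x\in\mathbb{R}^L_{\ge0}: x(\delta(S)\cap L)+\sum_{f\in\delta(S)\cap E(T)}x({\rm cov}(f))\ge|\delta(S)\cap E(T)|+1 \text{ for all } S\subseteq V \text{ with } |\delta(S)\cap E(T)| \text{ odd}\}$, where $x(F)=\sum_{\ell\in F}x_\ell$.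
   Formalization: Extremality in odd-LP is tested only against points with rational coordinates, α ranges over the rationals rather than the reals, and the convex weights in TAP membership are taken in ℚ. -}

module Defs where

open import Data.Bool using (Bool; true; false; _∧_; _∨_; _xor_; if_then_else_)
open import Data.Nat using (ℕ; zero; suc; _%_)
import Data.Nat as ℕ
open import Data.Fin using (Fin; zero; suc)
open import Data.Fin.Properties using (_≟_)
open import Data.List using (List; []; _∷_; allFin; foldr; map)
open import Data.Maybe using (Maybe; just; nothing)
open import Data.Product using (_×_; _,_; proj₁; proj₂; Σ)
open import Data.Integer using (+_)
open import Data.Rational using (ℚ; _+_; _*_; _-_; _≤_; _<_; 0ℚ; 1ℚ; ½; _/_)
open import Data.List.Relation.Unary.All using (All)
open import Relation.Binary.PropositionalEquality using (_≡_)
open import Relation.Nullary.Decidable using (⌊_⌋)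

Vertex : Set
Vertex = Fin 8

r u v w a₁ a₂ a₃ a₄ : Vertex
r = zero
u = suc zero
v = suc (suc zero)
w = suc (suc (suc zero))
a₁ = suc (suc (suc (suc zero)))
a₂ = suc (suc (suc (suc (suc zero))))
a₃ = suc (suc (suc (suc (suc (suc zero)))))
a₄ = suc (suc (suc (suc (suc (suc (suc zero))))))

parent : Vertex → Maybe Vertex
parent zero = nothing
parent (suc zero) = just r
parent (suc (suc zero)) = just r
parent (suc (suc (suc zero))) = just r
parent (suc (suc (suc (suc _)))) = just u

-- Tree edges: one per non-root vertex c, namely the edge {c, parent c}.
-- TreeEdge = Fin 7, where f corresponds to child vertex (suc f).
TreeEdge : Set
TreeEdge = Fin 7

child : TreeEdge → Vertex
child f = suc f

par : TreeEdge → Vertex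
par f with parent (suc f)
... | just p = p
... | nothing = r   -- unreachable: every non-root vertex has a parent

-- Links ℓ1..ℓ6, indexed by Fin 6 (ℓ_i ↦ i-1).
Link : Set
Link = Fin 6

ends : Link → Vertex × Vertex
ends zero = v , w
ends (suc zero) = a₄ , v
ends (suc (suc zero)) = a₂ , w
ends (suc (suc (suc zero))) = a₁ , w
ends (suc (suc (suc (suc zero)))) = a₁ , a₂
ends (suc (suc (suc (suc (suc zero))))) = a₃ , a₄

-- Covering.  The unique cycle of T + ℓ (ℓ = ab) consists of ℓ and the tree
-- path from a to b; the tree edge {c, parent c} lies on that path iff c is
-- an ancestor-or-self of exactly one of a, b.

-- isDescOf n x c : "c is reachable from x by following at most n parent
-- steps" (i.e. c is an ancestor-or-self of x); fuel 8 = |V| suffices.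
isDescOf : ℕ → Vertex → Vertex → Bool
isDescOf zero x c = ⌊ x ≟ c ⌋
isDescOf (suc n) x c with parent x
... | just p = ⌊ x ≟ c ⌋ ∨ isDescOf n p c
... | nothing = ⌊ x ≟ c ⌋

ancOrSelf : Vertex → Vertex → Bool
ancOrSelf c x = isDescOf 8 x c

covers : Link → TreeEdge → Bool
covers ℓ f = ancOrSelf (child f) (proj₁ (ends ℓ)) xor ancOrSelf (child f) (proj₂ (ends ℓ))

sumℚ : {A : Set} → List A → (A → ℚ) → ℚ
sumℚ xs g = foldr (λ a acc → g a + acc) 0ℚ xs

count : {A : Set} → List A → (A → Bool) → ℕ
count xs p = foldr (λ a acc → if p a then suc acc else acc) 0 xs

[_]ℚ : Bool → ℚ
[ true ]ℚ = 1ℚ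
[ false ]ℚ = 0ℚ

ℕtoℚ : ℕ → ℚ
ℕtoℚ n = + n / 1

xOf : (Link → ℚ) → (Link → Bool) → ℚ
xOf x F = sumℚ (allFin 6) (λ ℓ → [ F ℓ ]ℚ * x ℓ)

xCov : (Link → ℚ) → TreeEdge → ℚ
xCov x f = xOf x (λ ℓ → covers ℓ f)

Subset : Set
Subset = Vertex → Bool

linkInCut : Subset → Link → Bool
linkInCut S ℓ = S (proj₁ (ends ℓ)) xor S (proj₂ (ends ℓ))

treeEdgeInCut : Subset → TreeEdge → Bool
treeEdgeInCut S f = S (child f) xor S (par f)

cutTreeSize : Subset → ℕ
cutTreeSize S = count (allFin 7) (treeEdgeInCut S)

inOddLP : (Link → ℚ) → Set
inOddLP x =
  ((ℓ : Link) → 0ℚ ≤ x ℓ) ×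
  ((S : Subset) → cutTreeSize S % 2 ≡ 1 →
     ℕtoℚ (suc (cutTreeSize S))
       ≤ xOf x (linkInCut S)
         + sumℚ (allFin 7) (λ f → [ treeEdgeInCut S f ]ℚ * xCov x f))

IsExtremePoint : ((Link → ℚ) → Set) → (Link → ℚ) → Set
IsExtremePoint P z =
  P z ×
  ((p q : Link → ℚ) → P p → P q → (λ' : ℚ) → 0ℚ < λ' → λ' < 1ℚ →
     ((ℓ : Link) → z ℓ ≡ λ' * p ℓ + (1ℚ - λ') * q ℓ) →
     (ℓ : Link) → p ℓ ≡ q ℓ)

LinkSet : Set
LinkSet = Link → Bool

Feasible : LinkSet → Set
Feasible A = (f : TreeEdge) → Σ Link (λ ℓ → (A ℓ ≡ true) × (covers ℓ f ≡ true))

inTAP : (Link → ℚ) → Set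
inTAP z =
  Σ (List (ℚ × LinkSet)) λ comb →
    All (λ p → 0ℚ ≤ proj₁ p) comb ×
    sumℚ comb proj₁ ≡ 1ℚ ×
    All (λ p → Feasible (proj₂ p)) comb ×
    ((ℓ : Link) → sumℚ comb (λ p → proj₁ p * [ proj₂ p ℓ ]ℚ) ≤ z ℓ)

isInLink : Link → Bool
isInLink (suc (suc (suc (suc _)))) = true
isInLink _ = false

zPoint : Link → ℚ
zPoint (suc (suc (suc (suc (suc zero))))) = 1ℚ
zPoint _ = ½

scaleIn : ℚ → (Link → ℚ) → Link → ℚ
scaleIn α z ℓ = if isInLink ℓ then α * z ℓ else z ℓ

{-# OPTIONS --safe #-}
-- The six odd cuts {v}, {a₁}, {a₂}, {a₃}, {u,a₃,a₄} and {w,a₁,a₂} are tight at the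
-- point z = (½,½,½,½,½,1), and their constraint vectors are linearly independent, so z
-- is the unique point on which all six are tight. In a convex decomposition of z inside
-- odd-LP both points must keep every tight constraint tight, hence both equal z.
--
-- Every feasible TAP solution contains at least three of the links ℓ₁,…,ℓ₅, so
-- z(ℓ₁) + ⋯ + z(ℓ₅) ≥ 3 is a valid inequality for TAP(T,L); at (x, αy) the left-hand
-- side is 2 + α/2, which is below 3 for α < 2.
module Submission where

open import Defs
open import Data.Product using (_×_)
open import Data.Rational using (ℚ; _<_)
open import Data.Integer using (+_)
open import Data.Rational using (_/_)
open import Relation.Nullary using (¬_)

open import Algebra.Bundles using (CommutativeMonoid)
import Algebra.Properties.CommutativeSemigroup as CommSemigroupProperties
open import Data.Bool using (Bool; true)
import Data.Bool.Properties as Bool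
open import Data.Fin using (Fin; zero; suc; toℕ)
import Data.Fin.Properties as Fin
open import Data.Fin.Subset.Properties using (anySubset?)
open import Data.List using (List; []; _∷_; allFin; map)
open import Data.Bool.ListAction using (any)
open import Data.List.Properties using (map-tabulate)
open import Data.List.Relation.Unary.All as All using (All; []; _∷_)
import Data.Nat as ℕ
open import Data.Product using (_,_; proj₁; proj₂)
open import Data.Rational using (_+_; _*_; _-_; -_; _≤_; 0ℚ; 1ℚ; ½; positive; nonNegative)
import Data.Rational.Properties as ℚ
open import Data.Rational.Solver using (module +-*-Solver)
open import Data.Vec using (Vec; []; _∷_; lookup)
import Data.Vec as Vec
open import Data.Vec.Properties using (lookup∘tabulate)
open import Function using (id; _∘_)
open import Relation.Binary.PropositionalEquality
open import Relation.Nullary using (Dec; yes; no; ¬?; contradiction)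
open import Relation.Nullary.Decidable using (toWitness; ⌊_⌋; decidable-stable; _→-dec_; _×-dec_)

open CommSemigroupProperties (CommutativeMonoid.commutativeSemigroup ℚ.+-0-commutativeMonoid)
  using () renaming (interchange to +-interchange)
open CommSemigroupProperties (CommutativeMonoid.commutativeSemigroup ℚ.*-1-commutativeMonoid)
  using () renaming (x∙yz≈y∙xz to *-leftSwap)

module _ {A : Set} where

  sum-cong : (xs : List A) {f g : A → ℚ} → (∀ a → f a ≡ g a) → sumℚ xs f ≡ sumℚ xs g
  sum-cong []       f≗g = refl
  sum-cong (a ∷ xs) f≗g = cong₂ _+_ (f≗g a) (sum-cong xs f≗g)

  sum-mono : (xs : List A) {f g : A → ℚ} → (∀ a → f a ≤ g a) → sumℚ xs f ≤ sumℚ xs g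
  sum-mono []       f≤g = ℚ.≤-refl
  sum-mono (a ∷ xs) f≤g = ℚ.+-mono-≤ (f≤g a) (sum-mono xs f≤g)

  sum-mono-All : {P : A → Set} {xs : List A} {f g : A → ℚ} →
                 All P xs → (∀ a → P a → f a ≤ g a) → sumℚ xs f ≤ sumℚ xs g
  sum-mono-All []         f≤g = ℚ.≤-refl
  sum-mono-All (pa ∷ pxs) f≤g = ℚ.+-mono-≤ (f≤g _ pa) (sum-mono-All pxs f≤g)

  sum-0 : (xs : List A) → sumℚ xs (λ _ → 0ℚ) ≡ 0ℚ
  sum-0 []       = refl
  sum-0 (a ∷ xs) = cong (_+_ 0ℚ) (sum-0 xs)

  sum-+ : (xs : List A) (f g : A → ℚ) → sumℚ xs (λ a → f a + g a) ≡ sumℚ xs f + sumℚ xs g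
  sum-+ []       f g = refl
  sum-+ (a ∷ xs) f g =
    trans (cong (_+_ (f a + g a)) (sum-+ xs f g)) (+-interchange (f a) (g a) _ _)

  sum-*ˡ : (xs : List A) (c : ℚ) (f : A → ℚ) → sumℚ xs (λ a → c * f a) ≡ c * sumℚ xs f
  sum-*ˡ []       c f = sym (ℚ.*-zeroʳ c)
  sum-*ˡ (a ∷ xs) c f =
    trans (cong (_+_ (c * f a)) (sum-*ˡ xs c f)) (sym (ℚ.*-distribˡ-+ c (f a) _))

  sum-*ʳ : (xs : List A) (c : ℚ) (f : A → ℚ) → sumℚ xs (λ a → f a * c) ≡ sumℚ xs f * c
  sum-*ʳ xs c f =
    trans (sum-cong xs (λ a → ℚ.*-comm (f a) c)) (trans (sum-*ˡ xs c f) (ℚ.*-comm c _))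

  sum-map : {B : Set} (h : B → A) (xs : List B) (f : A → ℚ) → sumℚ (map h xs) f ≡ sumℚ xs (f ∘ h)
  sum-map h []       f = refl
  sum-map h (b ∷ xs) f = cong (_+_ (f (h b))) (sum-map h xs f)

sum-swap : {A B : Set} (xs : List A) (ys : List B) (h : A → B → ℚ) →
           sumℚ xs (λ a → sumℚ ys (h a)) ≡ sumℚ ys (λ b → sumℚ xs (λ a → h a b))
sum-swap []       ys h = sym (sum-0 ys)
sum-swap (a ∷ xs) ys h =
  trans (cong (_+_ (sumℚ ys (h a))) (sum-swap xs ys h)) (sym (sum-+ ys (h a) _))

sum-allFin-suc : ∀ {n} (g : Fin (ℕ.suc n) → ℚ) →
                 sumℚ (allFin (ℕ.suc n)) g ≡ g zero + sumℚ (allFin n) (g ∘ suc)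
sum-allFin-suc {n} g = cong (_+_ (g zero)) (begin
  sumℚ (Data.List.tabulate suc) g  ≡⟨ cong (λ xs → sumℚ xs g) (sym (map-tabulate id suc)) ⟩
  sumℚ (map suc (allFin n)) g      ≡⟨ sum-map suc (allFin n) g ⟩
  sumℚ (allFin n) (g ∘ suc)        ∎)
  where open ≡-Reasoning

-- Compared through toℕ so that unitVector (suc j) (suc i) reduces to unitVector j i.
unitVector : ∀ {n} → Fin n → Fin n → ℚ
unitVector j i = [ toℕ j ℕ.≡ᵇ toℕ i ]ℚ

sum-unitVector : ∀ {n} (j : Fin n) (x : Fin n → ℚ) →
                 sumℚ (allFin n) (λ i → unitVector j i * x i) ≡ x j
sum-unitVector {ℕ.suc n} zero x = begin
  sumℚ (allFin (ℕ.suc n)) (λ i → unitVector zero i * x i)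
    ≡⟨ sum-allFin-suc (λ i → unitVector zero i * x i) ⟩
  1ℚ * x zero + sumℚ (allFin n) (λ i → 0ℚ * x (suc i))
    ≡⟨ cong (_+_ (1ℚ * x zero)) (trans (sum-*ˡ (allFin n) 0ℚ (x ∘ suc)) (ℚ.*-zeroˡ (sumℚ (allFin n) (x ∘ suc)))) ⟩
  1ℚ * x zero + 0ℚ
    ≡⟨ trans (ℚ.+-identityʳ _) (ℚ.*-identityˡ _) ⟩
  x zero
    ∎
  where open ≡-Reasoning
sum-unitVector {ℕ.suc n} (suc j) x = begin
  sumℚ (allFin (ℕ.suc n)) (λ i → unitVector (suc j) i * x i)
    ≡⟨ sum-allFin-suc (λ i → unitVector (suc j) i * x i) ⟩
  0ℚ * x zero + sumℚ (allFin n) (λ i → unitVector j i * x (suc i))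
    ≡⟨ cong (_+_ (0ℚ * x zero)) (sum-unitVector j (x ∘ suc)) ⟩
  0ℚ * x zero + x (suc j)
    ≡⟨ trans (cong (_+ x (suc j)) (ℚ.*-zeroˡ (x zero))) (ℚ.+-identityˡ _) ⟩
  x (suc j)
    ∎
  where open ≡-Reasoning

allSubset? : ∀ {n} {P : Vec Bool n → Set} → (∀ v → Dec (P v)) → Dec (∀ v → P v)
allSubset? P? with anySubset? (¬? ∘ P?)
... | yes (v , ¬Pv) = no λ ∀P → ¬Pv (∀P v)
... | no ∄¬P        = yes λ v → decidable-stable (P? v) (λ ¬Pv → ∄¬P (v , ¬Pv))

dot : (Link → ℚ) → (Link → ℚ) → ℚ
dot c x = sumℚ (allFin 6) (λ ℓ → c ℓ * x ℓ)

dot-comm : ∀ c x → dot c x ≡ dot x c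
dot-comm c x = sum-cong (allFin 6) (λ ℓ → ℚ.*-comm (c ℓ) (x ℓ))

dot-congˡ : ∀ {c c'} x → (∀ ℓ → c ℓ ≡ c' ℓ) → dot c x ≡ dot c' x
dot-congˡ x c≗c' = sum-cong (allFin 6) (λ ℓ → cong (_* x ℓ) (c≗c' ℓ))

dot-monoʳ : ∀ {c x y} → (∀ ℓ → 0ℚ ≤ c ℓ) → (∀ ℓ → x ℓ ≤ y ℓ) → dot c x ≤ dot c y
dot-monoʳ {c} c≥0 x≤y =
  sum-mono (allFin 6) (λ ℓ → ℚ.*-monoˡ-≤-nonNeg (c ℓ) {{nonNegative (c≥0 ℓ)}} (x≤y ℓ))

dot-+ˡ : ∀ a b x → dot (λ ℓ → a ℓ + b ℓ) x ≡ dot a x + dot b x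
dot-+ˡ a b x = trans (sum-cong (allFin 6) (λ ℓ → ℚ.*-distribʳ-+ (x ℓ) (a ℓ) (b ℓ)))
                     (sum-+ (allFin 6) (λ ℓ → a ℓ * x ℓ) (λ ℓ → b ℓ * x ℓ))

dot-convex : ∀ c {z p q} l m → (∀ ℓ → z ℓ ≡ l * p ℓ + m * q ℓ) →
             dot c z ≡ l * dot c p + m * dot c q
dot-convex c {z} {p} {q} l m z≡ = begin
  dot c z                                                   ≡⟨ sum-cong (allFin 6) distribute ⟩
  sumℚ (allFin 6) (λ ℓ → l * (c ℓ * p ℓ) + m * (c ℓ * q ℓ))  ≡⟨ sum-+ (allFin 6) (λ ℓ → l * (c ℓ * p ℓ)) (λ ℓ → m * (c ℓ * q ℓ)) ⟩
  _                                                         ≡⟨ cong₂ _+_ (sum-*ˡ (allFin 6) l (λ ℓ → c ℓ * p ℓ)) (sum-*ˡ (allFin 6) m (λ ℓ → c ℓ * q ℓ)) ⟩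
  l * dot c p + m * dot c q                                 ∎
  where
  open ≡-Reasoning
  distribute : ∀ ℓ → c ℓ * z ℓ ≡ l * (c ℓ * p ℓ) + m * (c ℓ * q ℓ)
  distribute ℓ = begin
    c ℓ * z ℓ                           ≡⟨ cong (c ℓ *_) (z≡ ℓ) ⟩
    c ℓ * (l * p ℓ + m * q ℓ)           ≡⟨ ℚ.*-distribˡ-+ (c ℓ) _ _ ⟩
    c ℓ * (l * p ℓ) + c ℓ * (m * q ℓ)   ≡⟨ cong₂ _+_ (*-leftSwap (c ℓ) l _) (*-leftSwap (c ℓ) m _) ⟩
    l * (c ℓ * p ℓ) + m * (c ℓ * q ℓ)   ∎

dot-sumʳ : {A : Set} (xs : List A) (w : A → ℚ) (c : Link → ℚ) (y : A → Link → ℚ) →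
           dot c (λ ℓ → sumℚ xs (λ a → w a * y a ℓ)) ≡ sumℚ xs (λ a → w a * dot c (y a))
dot-sumʳ xs w c y = begin
  sumℚ (allFin 6) (λ ℓ → c ℓ * sumℚ xs (λ a → w a * y a ℓ))
    ≡⟨ sum-cong (allFin 6) (λ ℓ → sym (sum-*ˡ xs (c ℓ) (λ a → w a * y a ℓ))) ⟩
  sumℚ (allFin 6) (λ ℓ → sumℚ xs (λ a → c ℓ * (w a * y a ℓ)))
    ≡⟨ sum-swap (allFin 6) xs (λ ℓ a → c ℓ * (w a * y a ℓ)) ⟩
  sumℚ xs (λ a → sumℚ (allFin 6) (λ ℓ → c ℓ * (w a * y a ℓ)))
    ≡⟨ sum-cong xs (λ a → sum-cong (allFin 6) (λ ℓ → *-leftSwap (c ℓ) (w a) (y a ℓ))) ⟩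
  sumℚ xs (λ a → sumℚ (allFin 6) (λ ℓ → w a * (c ℓ * y a ℓ)))
    ≡⟨ sum-cong xs (λ a → sum-*ˡ (allFin 6) (w a) (λ ℓ → c ℓ * y a ℓ)) ⟩
  sumℚ xs (λ a → w a * dot c (y a))
    ∎
  where open ≡-Reasoning

dot-sumˡ : {A : Set} (xs : List A) (w : A → ℚ) (c : A → Link → ℚ) (x : Link → ℚ) →
           dot (λ ℓ → sumℚ xs (λ a → w a * c a ℓ)) x ≡ sumℚ xs (λ a → w a * dot (c a) x)
dot-sumˡ xs w c x = begin
  dot (λ ℓ → sumℚ xs (λ a → w a * c a ℓ)) x   ≡⟨ dot-comm (λ ℓ → sumℚ xs (λ a → w a * c a ℓ)) x ⟩
  dot x (λ ℓ → sumℚ xs (λ a → w a * c a ℓ))   ≡⟨ dot-sumʳ xs w x c ⟩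
  sumℚ xs (λ a → w a * dot x (c a))           ≡⟨ sum-cong xs (λ a → cong (w a *_) (dot-comm x (c a))) ⟩
  sumℚ xs (λ a → w a * dot (c a) x)           ∎
  where open ≡-Reasoning

convex-at-bound⇒at-boundˡ : ∀ {b p q l m} → 0ℚ < l → 0ℚ ≤ m → l + m ≡ 1ℚ →
                            b ≤ p → b ≤ q → l * p + m * q ≡ b → p ≡ b
convex-at-bound⇒at-boundˡ {b} {p} {q} {l} {m} l>0 m≥0 l+m≡1 b≤p b≤q lp+mq≡b with p ℚ.≤? b
... | yes p≤b = ℚ.≤-antisym p≤b b≤p
... | no  p≰b = contradiction (subst₂ _<_ lb+mb≡b lp+mq≡b lb+mb<lp+mq) (ℚ.<-irrefl refl)
  where
  lb+mb≡b : l * b + m * b ≡ b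
  lb+mb≡b = trans (sym (ℚ.*-distribʳ-+ b l m)) (trans (cong (_* b) l+m≡1) (ℚ.*-identityˡ b))
  lb+mb<lp+mq : l * b + m * b < l * p + m * q
  lb+mb<lp+mq = ℚ.+-mono-<-≤ (ℚ.*-monoʳ-<-pos l {{positive l>0}} (ℚ.≰⇒> p≰b))
                             (ℚ.*-monoˡ-≤-nonNeg m {{nonNegative m≥0}} b≤q)

OddCut : Subset → Set
OddCut S = cutTreeSize S ℕ.% 2 ≡ 1

OddCut? : ∀ S → Dec (OddCut S)
OddCut? S = cutTreeSize S ℕ.% 2 ℕ.≟ 1

cutDemand : Subset → ℚ
cutDemand S = ℕtoℚ (ℕ.suc (cutTreeSize S))

cutValue : Subset → (Link → ℚ) → ℚ
cutValue S x = xOf x (linkInCut S) + sumℚ (allFin 7) (λ f → [ treeEdgeInCut S f ]ℚ * xCov x f)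

cutCoeff : Subset → Link → ℚ
cutCoeff S ℓ = [ linkInCut S ℓ ]ℚ + sumℚ (allFin 7) (λ f → [ treeEdgeInCut S f ]ℚ * [ covers ℓ f ]ℚ)

cutValue-linear : ∀ S x → cutValue S x ≡ dot (cutCoeff S) x
cutValue-linear S x = begin
  dot inCut x + sumℚ (allFin 7) (λ f → edgeInCut f * dot (covering f) x)
    ≡⟨ cong (_+_ (dot inCut x)) (dot-sumˡ (allFin 7) edgeInCut covering x) ⟨
  dot inCut x + dot (λ ℓ → sumℚ (allFin 7) (λ f → edgeInCut f * covering f ℓ)) x
    ≡⟨ dot-+ˡ inCut (λ ℓ → sumℚ (allFin 7) (λ f → edgeInCut f * covering f ℓ)) x ⟨
  dot (cutCoeff S) x
    ∎
  where
  open ≡-Reasoning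
  inCut : Link → ℚ
  inCut ℓ = [ linkInCut S ℓ ]ℚ
  edgeInCut : TreeEdge → ℚ
  edgeInCut f = [ treeEdgeInCut S f ]ℚ
  covering : TreeEdge → Link → ℚ
  covering f ℓ = [ covers ℓ f ]ℚ

zPoint-nonneg : ∀ ℓ → 0ℚ ≤ zPoint ℓ
zPoint-nonneg = toWitness {a? = Fin.all? (λ ℓ → 0ℚ ℚ.≤? zPoint ℓ)} _

zPoint-satisfies-oddCuts : ∀ S → OddCut S → cutDemand S ≤ cutValue S zPoint
zPoint-satisfies-oddCuts S = onAllSubsets (Vec.tabulate S)
  where
  onAllSubsets : ∀ v → OddCut (lookup v) → cutDemand (lookup v) ≤ cutValue (lookup v) zPoint
  onAllSubsets = toWitness {a? = allSubset? λ v →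
    OddCut? (lookup v) →-dec (cutDemand (lookup v) ℚ.≤? cutValue (lookup v) zPoint)} _

vertexSet : List Vertex → Subset
vertexSet xs x = any (λ y → ⌊ x Fin.≟ y ⌋) xs

tightCut : Fin 6 → Subset
tightCut = lookup ( vertexSet (v ∷ [])
                  ∷ vertexSet (a₁ ∷ [])
                  ∷ vertexSet (a₂ ∷ [])
                  ∷ vertexSet (a₃ ∷ [])
                  ∷ vertexSet (u ∷ a₃ ∷ a₄ ∷ [])
                  ∷ vertexSet (w ∷ a₁ ∷ a₂ ∷ [])
                  ∷ [])

tightCut-tight : ∀ i → OddCut (tightCut i) × cutValue (tightCut i) zPoint ≡ cutDemand (tightCut i)
tightCut-tight = toWitness {a? = Fin.all? λ i →
  OddCut? (tightCut i) ×-dec (cutValue (tightCut i) zPoint ℚ.≟ cutDemand (tightCut i))} _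

-- Row ℓ holds the multipliers of the tight cut constraints summing to the ℓ-th unit vector.
cutInverse : Link → Fin 6 → ℚ
cutInverse = lookup ∘ lookup
  ( ( ¼ ∷ 0ℚ ∷ 0ℚ ∷ 0ℚ ∷ - ¼ ∷ ¼ ∷ [])
  ∷ ( ¼ ∷ 0ℚ ∷ 0ℚ ∷ 0ℚ ∷ ¼ ∷ - ¼ ∷ [])
  ∷ (- ¼ ∷ - ½ ∷ 0ℚ ∷ 0ℚ ∷ ¼ ∷ ¼ ∷ [])
  ∷ (- ¼ ∷ 0ℚ ∷ - ½ ∷ 0ℚ ∷ ¼ ∷ ¼ ∷ [])
  ∷ ( ¼ ∷ ½ ∷ ½ ∷ 0ℚ ∷ - ¼ ∷ - ¼ ∷ [])
  ∷ ( 0ℚ ∷ 0ℚ ∷ 0ℚ ∷ ½ ∷ 0ℚ ∷ 0ℚ ∷ [])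
  ∷ [])
  where
  ¼ : ℚ
  ¼ = + 1 / 4

cutInverse-spec : ∀ ℓ ℓ' →
  sumℚ (allFin 6) (λ i → cutInverse ℓ i * cutCoeff (tightCut i) ℓ') ≡ unitVector ℓ ℓ'
cutInverse-spec = toWitness {a? = Fin.all? λ ℓ → Fin.all? λ ℓ' →
  sumℚ (allFin 6) (λ i → cutInverse ℓ i * cutCoeff (tightCut i) ℓ') ℚ.≟ unitVector ℓ ℓ'} _

coordinate-from-tightCuts : ∀ x ℓ →
  x ℓ ≡ sumℚ (allFin 6) (λ i → cutInverse ℓ i * cutValue (tightCut i) x)
coordinate-from-tightCuts x ℓ = begin
  x ℓ
    ≡⟨ sym (sum-unitVector ℓ x) ⟩
  dot (unitVector ℓ) x
    ≡⟨ dot-congˡ x (λ ℓ' → sym (cutInverse-spec ℓ ℓ')) ⟩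
  dot (λ ℓ' → sumℚ (allFin 6) (λ i → cutInverse ℓ i * cutCoeff (tightCut i) ℓ')) x
    ≡⟨ dot-sumˡ (allFin 6) (cutInverse ℓ) (cutCoeff ∘ tightCut) x ⟩
  sumℚ (allFin 6) (λ i → cutInverse ℓ i * dot (cutCoeff (tightCut i)) x)
    ≡⟨ sum-cong (allFin 6) (λ i → cong (cutInverse ℓ i *_) (sym (cutValue-linear (tightCut i) x))) ⟩
  sumℚ (allFin 6) (λ i → cutInverse ℓ i * cutValue (tightCut i) x)
    ∎
  where open ≡-Reasoning

tightCuts-determine-zPoint : ∀ x → (∀ i → cutValue (tightCut i) x ≡ cutDemand (tightCut i)) →
                             ∀ ℓ → x ℓ ≡ zPoint ℓ
tightCuts-determine-zPoint x x-tight ℓ =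
  trans (coordinate-from-tightCuts x ℓ)
        (trans (sum-cong (allFin 6) (λ i → cong (cutInverse ℓ i *_) (same-value i)))
               (sym (coordinate-from-tightCuts zPoint ℓ)))
  where
  same-value : ∀ i → cutValue (tightCut i) x ≡ cutValue (tightCut i) zPoint
  same-value i = trans (x-tight i) (sym (proj₂ (tightCut-tight i)))

tightCuts-tight-in-decomposition :
  ∀ {p q l m} → inOddLP p → inOddLP q → 0ℚ < l → 0ℚ ≤ m → l + m ≡ 1ℚ →
  (∀ ℓ → zPoint ℓ ≡ l * p ℓ + m * q ℓ) → ∀ i → cutValue (tightCut i) p ≡ cutDemand (tightCut i)
tightCuts-tight-in-decomposition {p} {q} {l} {m} (_ , p-cuts) (_ , q-cuts) l>0 m≥0 l+m≡1 z≡ i =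
  convex-at-bound⇒at-boundˡ l>0 m≥0 l+m≡1 (p-cuts S odd) (q-cuts S odd) (begin
    l * cutValue S p + m * cutValue S q
      ≡⟨ cong₂ (λ a b → l * a + m * b) (cutValue-linear S p) (cutValue-linear S q) ⟩
    l * dot (cutCoeff S) p + m * dot (cutCoeff S) q
      ≡⟨ dot-convex (cutCoeff S) l m z≡ ⟨
    dot (cutCoeff S) zPoint
      ≡⟨ cutValue-linear S zPoint ⟨
    cutValue S zPoint
      ≡⟨ tight ⟩
    cutDemand S
      ∎)
  where
  open ≡-Reasoning
  S : Subset
  S = tightCut i
  odd : OddCut S
  odd = proj₁ (tightCut-tight i)
  tight : cutValue S zPoint ≡ cutDemand S
  tight = proj₂ (tightCut-tight i)

zPoint-extreme : IsExtremePoint inOddLP zPoint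
zPoint-extreme = (zPoint-nonneg , zPoint-satisfies-oddCuts) , decomposition-trivial
  where
  open +-*-Solver
  decomposition-trivial : (p q : Link → ℚ) → inOddLP p → inOddLP q → (l : ℚ) → 0ℚ < l → l < 1ℚ →
                          (∀ ℓ → zPoint ℓ ≡ l * p ℓ + (1ℚ - l) * q ℓ) → ∀ ℓ → p ℓ ≡ q ℓ
  decomposition-trivial p q p∈ q∈ l l>0 l<1 z≡ ℓ = trans (p≗z ℓ) (sym (q≗z ℓ))
    where
    m>0 : 0ℚ < 1ℚ - l
    m>0 = subst (_< 1ℚ - l) (ℚ.+-inverseʳ l) (ℚ.+-monoˡ-< (- l) l<1)
    l+m≡1 : l + (1ℚ - l) ≡ 1ℚ
    l+m≡1 = solve 1 (λ l → l :+ (con 1ℚ :- l) := con 1ℚ) refl l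
    p≗z : ∀ ℓ → p ℓ ≡ zPoint ℓ
    p≗z = tightCuts-determine-zPoint p
            (tightCuts-tight-in-decomposition p∈ q∈ l>0 (ℚ.<⇒≤ m>0) l+m≡1 z≡)
    q≗z : ∀ ℓ → q ℓ ≡ zPoint ℓ
    q≗z = tightCuts-determine-zPoint q
            (tightCuts-tight-in-decomposition q∈ p∈ m>0 (ℚ.<⇒≤ l>0)
               (trans (ℚ.+-comm (1ℚ - l) l) l+m≡1) (λ ℓ → trans (z≡ ℓ) (ℚ.+-comm (l * p ℓ) _)))

χ : LinkSet → Link → ℚ
χ B ℓ = [ B ℓ ]ℚ

Feasible? : ∀ B → Dec (Feasible B)
Feasible? B = Fin.all? λ f → Fin.any? λ ℓ → (B ℓ Bool.≟ true) ×-dec (covers ℓ f Bool.≟ true)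

Feasible-resp-≗ : ∀ {B B'} → (∀ ℓ → B ℓ ≡ B' ℓ) → Feasible B → Feasible B'
Feasible-resp-≗ B≗B' feasible f =
  let (ℓ , ℓ∈B , ℓ-covers) = feasible f in ℓ , trans (sym (B≗B' ℓ)) ℓ∈B , ℓ-covers

inTAP⇒valid : ∀ {c k z} → (∀ ℓ → 0ℚ ≤ c ℓ) → (∀ B → Feasible B → k ≤ dot c (χ B)) →
              inTAP z → k ≤ dot c z
inTAP⇒valid {c} {k} {z} c≥0 valid (comb , λ≥0 , Σλ≡1 , feasible , dominated) = begin
  k                                                           ≡⟨ Σλk≡k ⟨
  sumℚ comb (λ a → proj₁ a * k)                               ≤⟨ sum-mono-All (All.zip (λ≥0 , feasible)) bound ⟩
  sumℚ comb (λ a → proj₁ a * dot c (χ (proj₂ a)))              ≡⟨ dot-sumʳ comb proj₁ c (χ ∘ proj₂) ⟨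
  dot c (λ ℓ → sumℚ comb (λ a → proj₁ a * [ proj₂ a ℓ ]ℚ))     ≤⟨ dot-monoʳ c≥0 dominated ⟩
  dot c z                                                     ∎
  where
  open ℚ.≤-Reasoning
  Σλk≡k : sumℚ comb (λ a → proj₁ a * k) ≡ k
  Σλk≡k = trans (sum-*ʳ comb k proj₁) (trans (cong (_* k) Σλ≡1) (ℚ.*-identityˡ k))
  bound : ∀ a → 0ℚ ≤ proj₁ a × Feasible (proj₂ a) → proj₁ a * k ≤ proj₁ a * dot c (χ (proj₂ a))
  bound a (λ≥0 , feasible) = ℚ.*-monoˡ-≤-nonNeg (proj₁ a) {{nonNegative λ≥0}} (valid (proj₂ a) feasible)

allButℓ₆ : Link → ℚ
allButℓ₆ (suc (suc (suc (suc (suc zero))))) = 0ℚ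
allButℓ₆ _                                   = 1ℚ

three : ℚ
three = + 3 / 1

allButℓ₆-nonneg : ∀ ℓ → 0ℚ ≤ allButℓ₆ ℓ
allButℓ₆-nonneg = toWitness {a? = Fin.all? (λ ℓ → 0ℚ ℚ.≤? allButℓ₆ ℓ)} _

feasible⇒three≤allButℓ₆ : ∀ B → Feasible B → three ≤ dot allButℓ₆ (χ B)
feasible⇒three≤allButℓ₆ B feasible =
  onAllSubsets (Vec.tabulate B) (Feasible-resp-≗ (λ ℓ → sym (lookup∘tabulate B ℓ)) feasible)
  where
  onAllSubsets : ∀ v → Feasible (lookup v) → three ≤ dot allButℓ₆ (χ (lookup v))
  onAllSubsets = toWitness {a? = allSubset? λ v →
    Feasible? (lookup v) →-dec (three ℚ.≤? dot allButℓ₆ (χ (lookup v)))} _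

allButℓ₆-scaled<three : ∀ α → α < + 2 / 1 → dot allButℓ₆ (scaleIn α zPoint) < three
allButℓ₆-scaled<three α α<2 = subst (_< three) (sym value) (ℚ.+-monoʳ-< (+ 2 / 1) (ℚ.*-monoʳ-<-pos ½ α<2))
  where
  open +-*-Solver
  value : dot allButℓ₆ (scaleIn α zPoint) ≡ + 2 / 1 + ½ * α
  value = solve 1 (λ α → con ½ :+ (con ½ :+ (con ½ :+ (con ½ :+ (con 1ℚ :* (α :* con ½)
                          :+ (con 0ℚ :* (α :* con 1ℚ) :+ con 0ℚ)))))
                         := con (+ 2 / 1) :+ con ½ :* α) refl α

mainTheorem4 : IsExtremePoint inOddLP zPoint
    × ((α : ℚ) → α < (+ 2 / 1) → ¬ inTAP (scaleIn α zPoint))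
mainTheorem4 = zPoint-extreme , scaled-notInTAP
  where
  scaled-notInTAP : (α : ℚ) → α < (+ 2 / 1) → ¬ inTAP (scaleIn α zPoint)
  scaled-notInTAP α α<2 z∈TAP = ℚ.<-irrefl refl
    (ℚ.≤-<-trans (inTAP⇒valid allButℓ₆-nonneg feasible⇒three≤allButℓ₆ z∈TAP)
                 (allButℓ₆-scaled<three α α<2))
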